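{- Fix $\gamma\ge0$ and let $\beta^\star_i(\gamma)=\max\{0,\,c(i)+V^f(\gamma,i)-\gamma\}$ for $i\in S$. Then for every $a\in S$, $$V(\gamma,a)=c^f(a)-\sum_{i\in\mathrm{sub}(a)}\beta^\star_i(\gamma)\frac{\pi(i)}{\pi(a)}.$$
   Context: Let $S$ be a finite rooted tree with root $r$ and levels $S_0=\{r\},\dots,S_{L-1}$. Each non-root $i$ has a unique parent $\mathrm{pa}(i)$, and $\mathrm{child}(i)=\{k:\mathrm{pa}(k)=i\}$. The transition probabilities satisfy $P(\mathrm{pa}(i),i)>0$ and $\sum_{k\in\mathrm{child}(i)}P(i,k)\le1$. Costs are $c(i)>0$. Notation: - $\mathrm{anc}(i)$ is the set of states on the path from $r$ to $i$, inclusive. - $\mathrm{sub}(a)=\{i:a\in\mathrm{anc}(i)\}$. - $\pi(r)=1$ and $\pi(i)=\prod_{k\in\mathrm{anc}(i)\setminus\{r\}}P(\mathrm{pa}(k),k)$. - $c^f(a)=\sum_{i\in\mathrm{sub}(a)}c(i)\pi(i)/\pi(a)$. - $V(\gamma,i)=\min\{\gamma,c(i)+V^f(\gamma,i)\}$ and $V^f(\gamma,i)=\sum_{k\in\mathrm{child}(i)}P(i,k)V(\gamma,k)$, with the empty sum equal to $0$.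
   Formalization: The costs $c(i)$, the transition probabilities $P(\mathrm{pa}(i),i)$ and the parameter γ take rational values. -}

module Defs where

open import Data.Rational using (ℚ; 0ℚ; 1ℚ; _+_; _*_; _-_; _÷_; _⊔_; _⊓_; _<_; _≤_; ≢-nonZero)
open import Data.Rational.Properties using (_≟_)
open import Data.List using (List; []; _∷_; map; _++_; foldr)
open import Data.Product using (_×_)
open import Data.Unit using (⊤)
open import Relation.Nullary using (yes; no)

-- A finite rooted tree of states. Each node carries its cost c(i);
-- each child edge carries the transition probability P(pa(k),k).
data Tree : Set
data Forest : Set

data Tree where
  node : (cost : ℚ) → Forest → Tree

data Forest where
  nil  : Forest
  cons : (prob : ℚ) → Tree → Forest → Forest

-- States of S = positions (paths from the root) in the tree.
data Pos : Tree → Set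
data PosF : Forest → Set

data Pos where
  here : ∀ {c f} → Pos (node c f)
  down : ∀ {c f} → PosF f → Pos (node c f)

data PosF where
  hd : ∀ {p t f} → Pos t → PosF (cons p t f)
  tl : ∀ {p t f} → PosF f → PosF (cons p t f)

at  : (t : Tree) → Pos t → Tree
atF : (f : Forest) → PosF f → Tree
at (node c f) here     = node c f
at (node c f) (down q) = atF f q
atF (cons p t f) (hd i) = at t i
atF (cons p t f) (tl q) = atF f q

cost : Tree → ℚ
cost (node c f) = c

cAt : (t : Tree) → Pos t → ℚ
cAt t i = cost (at t i)

π  : {t : Tree} → Pos t → ℚ
πF : {f : Forest} → PosF f → ℚ
π here     = 1ℚ
π (down q) = πF q
πF {cons p t f} (hd i) = p * π i
πF (tl q) = πF q

extend  : {t : Tree} (a : Pos t) → Pos (at t a) → Pos t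
extendF : {f : Forest} (q : PosF f) → Pos (atF f q) → PosF f
extend here     j = j
extend (down q) j = down (extendF q j)
extendF (hd i) j = hd (extend i j)
extendF (tl q) j = tl (extendF q j)

allPos  : (t : Tree) → List (Pos t)
allPosF : (f : Forest) → List (PosF f)
allPos (node c f) = here ∷ map down (allPosF f)
allPosF nil = []
allPosF (cons p t f) = map hd (allPos t) ++ map tl (allPosF f)

sumℚ : List ℚ → ℚ
sumℚ = foldr _+_ 0ℚ

-- Σ_{i ∈ sub(a)} g(i), where sub(a) = { i : a ∈ anc(i) } is enumerated as
-- the states a·j for j ranging over the states of the subtree at a.
Σsub : (t : Tree) → Pos t → (Pos t → ℚ) → ℚ
Σsub t a g = sumℚ (map (λ j → g (extend a j)) (allPos (at t a)))

-- total division (x / 0 := 0); only ever used with nonzero denominator π(a)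
_÷′_ : ℚ → ℚ → ℚ
x ÷′ y with y ≟ 0ℚ
... | yes _ = 0ℚ
... | no ne = _÷_ x y {{≢-nonZero ne}}

V  : ℚ → Tree → ℚ
VF : ℚ → Forest → ℚ
V γ (node c f) = γ ⊓ (c + VF γ f)
VF γ nil = 0ℚ
VF γ (cons p t f) = p * V γ t + VF γ f

Vf : ℚ → Tree → ℚ
Vf γ (node c f) = VF γ f

β⋆ : ℚ → (t : Tree) → Pos t → ℚ
β⋆ γ t i = 0ℚ ⊔ (cAt t i + Vf γ (at t i) - γ)

cf : (t : Tree) → Pos t → ℚ
cf t a = Σsub t a (λ i → (cAt t i * π i) ÷′ π a)

probSum : Forest → ℚ
probSum nil = 0ℚ
probSum (cons p t f) = p + probSum f

Valid  : Tree → Set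
ValidF : Forest → Set
Valid (node c f) = (0ℚ < c) × (probSum f ≤ 1ℚ) × ValidF f
ValidF nil = ⊤
ValidF (cons p t f) = (0ℚ < p) × Valid t × ValidF f

{-# OPTIONS --safe #-}
module Submission where

open import Defs
open import Data.Rational
  using (ℚ; 0ℚ; 1ℚ; _<_; _≤_; _+_; _-_; _*_; -_; _⊓_; _⊔_; 1/_; ≢-nonZero; positive)
open import Data.Rational.Properties
open import Data.Rational.Solver using (module +-*-Solver)
open import Data.List using (List; []; _∷_; map; _++_)
open import Data.List.Properties using (map-∘; map-cong)
open import Data.Product using (_,_)
open import Function using (_∘_)
open import Relation.Nullary using (yes; no; contradiction)
open import Relation.Binary.PropositionalEquality

open +-*-Solver
open ≡-Reasoning

-- Since min{γ, x} = x − max{0, x − γ}, we have V(γ,i) = (c(i) − β⋆_i) + V^f(γ,i).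
-- Unrolling this recursion expresses V(γ,a) as the sum over sub(a) of c − β⋆, weighted by
-- path probabilities measured from a. As π(a·j) = π(a) π(j), these are exactly the weights
-- π(i)/π(a) of the statement; π(a) > 0 because every transition probability is positive.

Σ : {A : Set} → List A → (A → ℚ) → ℚ
Σ xs g = sumℚ (map g xs)

Σ-cong : {A : Set} (xs : List A) {f g : A → ℚ} → (∀ x → f x ≡ g x) → Σ xs f ≡ Σ xs g
Σ-cong xs f≗g = cong sumℚ (map-cong f≗g xs)

Σ-map : {A B : Set} (h : A → B) (xs : List A) (g : B → ℚ) → Σ (map h xs) g ≡ Σ xs (g ∘ h)
Σ-map h xs g = cong sumℚ (sym (map-∘ xs))

Σ-++ : {A : Set} (xs ys : List A) (g : A → ℚ) → Σ (xs ++ ys) g ≡ Σ xs g + Σ ys g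
Σ-++ []       ys g = sym (+-identityˡ _)
Σ-++ (x ∷ xs) ys g = trans (cong (g x +_) (Σ-++ xs ys g)) (sym (+-assoc (g x) _ _))

Σ-*ˡ : {A : Set} (p : ℚ) (xs : List A) (g : A → ℚ) → Σ xs (λ x → p * g x) ≡ p * Σ xs g
Σ-*ˡ p []       g = sym (*-zeroʳ p)
Σ-*ˡ p (x ∷ xs) g = trans (cong (p * g x +_) (Σ-*ˡ p xs g)) (sym (*-distribˡ-+ p (g x) _))

Σ-- : {A : Set} (xs : List A) (f g : A → ℚ) → Σ xs (λ x → f x - g x) ≡ Σ xs f - Σ xs g
Σ-- []       f g = refl
Σ-- (x ∷ xs) f g = begin
  (f x - g x) + Σ xs (λ y → f y - g y)
    ≡⟨ cong ((f x - g x) +_) (Σ-- xs f g) ⟩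
  (f x - g x) + (Σ xs f - Σ xs g)
    ≡⟨ solve 4 (λ a b c d → (a :- b) :+ (c :- d) := (a :+ c) :- (b :+ d)) refl (f x) (g x) (Σ xs f) (Σ xs g) ⟩
  (f x + Σ xs f) - (g x + Σ xs g)
    ∎

*-distribʳ-- : ∀ p x y → (x - y) * p ≡ x * p - y * p
*-distribʳ-- p x y = solve 3 (λ p′ x′ y′ → (x′ :- y′) :* p′ := x′ :* p′ :- y′ :* p′) refl p x y

*-left-comm : ∀ x y z → x * (y * z) ≡ y * (x * z)
*-left-comm x y z = solve 3 (λ x′ y′ z′ → x′ :* (y′ :* z′) := y′ :* (x′ :* z′)) refl x y z

Σ-allPos-node : ∀ {c f} (g : Pos (node c f) → ℚ) →
  Σ (allPos (node c f)) g ≡ g here + Σ (allPosF f) (g ∘ down)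
Σ-allPos-node {f = f} g = cong (g here +_) (Σ-map down (allPosF f) g)

Σ-allPosF-cons : ∀ {p t f} (g : PosF (cons p t f) → ℚ) →
  Σ (allPosF (cons p t f)) g ≡ Σ (allPos t) (g ∘ hd) + Σ (allPosF f) (g ∘ tl)
Σ-allPosF-cons {t = t} {f = f} g = begin
  Σ (map hd (allPos t) ++ map tl (allPosF f)) g       ≡⟨ Σ-++ (map hd (allPos t)) _ g ⟩
  Σ (map hd (allPos t)) g + Σ (map tl (allPosF f)) g
    ≡⟨ cong₂ _+_ (Σ-map hd (allPos t) g) (Σ-map tl (allPosF f) g) ⟩
  Σ (allPos t) (g ∘ hd) + Σ (allPosF f) (g ∘ tl)      ∎

-- Negation swaps ⊔ for ⊓, and translation by x distributes over ⊓.
⊓-as-⊔ : ∀ γ x → γ ⊓ x ≡ x - (0ℚ ⊔ (x - γ))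
⊓-as-⊔ γ x = sym (begin
  x + - (0ℚ ⊔ (x - γ))         ≡⟨ cong (x +_) (antimono-≤-distrib-⊔ neg-antimono-≤ 0ℚ (x - γ)) ⟩
  x + (- 0ℚ ⊓ - (x - γ))       ≡⟨ mono-≤-distrib-⊓ (+-monoʳ-≤ x) (- 0ℚ) (- (x - γ)) ⟩
  (x + - 0ℚ) ⊓ (x + - (x - γ)) ≡⟨ cong₂ _⊓_ (solve 1 (λ y → y :- con 0ℚ := y) refl x)
                                             (solve 2 (λ y g → y :- (y :- g) := g) refl x γ) ⟩
  x ⊓ γ                        ≡⟨ ⊓-comm x γ ⟩
  γ ⊓ x                        ∎)

module _ (γ : ℚ) where

  -- β⋆ γ S i unfolds to slack (at S i).
  slack : Tree → ℚ
  slack T = 0ℚ ⊔ (cost T + Vf γ T - γ)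

  netCost : Tree → ℚ
  netCost T = cost T - slack T

  V-node : ∀ c f → V γ (node c f) ≡ netCost (node c f) + VF γ f
  V-node c f = trans (⊓-as-⊔ γ (c + VF γ f))
    (solve 3 (λ c′ v s → (c′ :+ v) :- s := (c′ :- s) :+ v) refl c (VF γ f) (slack (node c f)))

  V-as-Σ  : ∀ T → V γ T ≡ Σ (allPos T) (λ j → netCost (at T j) * π j)
  VF-as-Σ : ∀ f → VF γ f ≡ Σ (allPosF f) (λ q → netCost (atF f q) * πF q)
  V-as-Σ (node c f) = begin
    V γ (node c f)                              ≡⟨ V-node c f ⟩
    netCost (node c f) + VF γ f                 ≡⟨ cong₂ _+_ (sym (*-identityʳ (netCost (node c f))))
                                                             (VF-as-Σ f) ⟩
    weight here + Σ (allPosF f) (weight ∘ down) ≡⟨ sym (Σ-allPos-node weight) ⟩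
    Σ (allPos (node c f)) weight                ∎
    where
    weight : Pos (node c f) → ℚ
    weight j = netCost (at (node c f) j) * π j
  VF-as-Σ nil = refl
  VF-as-Σ (cons p t f) = sym (begin
    Σ (allPosF (cons p t f)) weight
      ≡⟨ Σ-allPosF-cons weight ⟩
    Σ (allPos t) (λ i → netCost (at t i) * (p * π i)) + rest
      ≡⟨ cong (_+ rest) (Σ-cong (allPos t) λ i → *-left-comm (netCost (at t i)) p (π i)) ⟩
    Σ (allPos t) (λ i → p * (netCost (at t i) * π i)) + rest
      ≡⟨ cong (_+ rest) (Σ-*ˡ p (allPos t) _) ⟩
    p * Σ (allPos t) (λ i → netCost (at t i) * π i) + rest
      ≡⟨ cong₂ (λ x y → p * x + y) (sym (V-as-Σ t)) (sym (VF-as-Σ f)) ⟩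
    p * V γ t + VF γ f
      ∎)
    where
    weight : PosF (cons p t f) → ℚ
    weight q = netCost (atF (cons p t f) q) * πF q
    rest : ℚ
    rest = Σ (allPosF f) (λ q → netCost (atF f q) * πF q)

at-extend  : {T : Tree} (a : Pos T) (j : Pos (at T a)) → at T (extend a j) ≡ at (at T a) j
atF-extendF : {f : Forest} (q : PosF f) (j : Pos (atF f q)) → atF f (extendF q j) ≡ at (atF f q) j
at-extend here     j = refl
at-extend (down q) j = atF-extendF q j
atF-extendF (hd i) j = at-extend i j
atF-extendF (tl q) j = atF-extendF q j

π-extend  : {T : Tree} (a : Pos T) (j : Pos (at T a)) → π (extend a j) ≡ π a * π j
πF-extendF : {f : Forest} (q : PosF f) (j : Pos (atF f q)) → πF (extendF q j) ≡ πF q * π j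
π-extend here     j = sym (*-identityˡ _)
π-extend (down q) j = πF-extendF q j
πF-extendF {cons p t f} (hd i) j = trans (cong (p *_) (π-extend i j)) (sym (*-assoc p _ _))
πF-extendF (tl q) j = πF-extendF q j

π-pos  : {T : Tree} → Valid T → (a : Pos T) → 0ℚ < π a
πF-pos : {f : Forest} → ValidF f → (q : PosF f) → 0ℚ < πF q
π-pos _             here     = positive⁻¹ 1ℚ
π-pos (_ , _ , vf)  (down q) = πF-pos vf q
πF-pos {cons p t f} (p>0 , vt , _) (hd i) =
  positive⁻¹ (p * π i) {{pos*pos⇒pos p {{positive p>0}} (π i) {{positive (π-pos vt i)}}}}
πF-pos (_ , _ , vf) (tl q) = πF-pos vf q

*-÷′-assoc : ∀ x y z → (x * y) ÷′ z ≡ x * (y ÷′ z)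
*-÷′-assoc x y z with z ≟ 0ℚ
... | yes _  = sym (*-zeroʳ x)
... | no z≢0 = *-assoc x y (1/_ z {{≢-nonZero z≢0}})

*-÷′-cancelˡ : ∀ {y} → 0ℚ < y → ∀ x → (y * x) ÷′ y ≡ x
*-÷′-cancelˡ {y} y>0 x with y ≟ 0ℚ
... | yes y≡0 = contradiction (sym y≡0) (<⇒≢ y>0)
... | no y≢0  = begin
  y * x * 1/ y   ≡⟨ cong (_* 1/ y) (*-comm y x) ⟩
  x * y * 1/ y   ≡⟨ *-assoc x y (1/ y) ⟩
  x * (y * 1/ y) ≡⟨ cong (x *_) (*-inverseʳ y) ⟩
  x * 1ℚ         ≡⟨ *-identityʳ x ⟩
  x              ∎
  where instance _ = ≢-nonZero y≢0

π-extend-÷′ : {S : Tree} → Valid S → (a : Pos S) (j : Pos (at S a)) → π (extend a j) ÷′ π a ≡ π j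
π-extend-÷′ valid a j = trans (cong (_÷′ π a) (π-extend a j)) (*-÷′-cancelˡ (π-pos valid a) (π j))

Σsub-relative : {S : Tree} → Valid S → (a : Pos S) (g : Tree → ℚ) →
  Σsub S a (λ i → g (at S i) * (π i ÷′ π a)) ≡ Σ (allPos (at S a)) (λ j → g (at (at S a) j) * π j)
Σsub-relative valid a g = Σ-cong (allPos _) λ j →
  cong₂ (λ T x → g T * x) (at-extend a j) (π-extend-÷′ valid a j)

lemma14 : (S : Tree) → Valid S → (γ : ℚ) → 0ℚ ≤ γ → (a : Pos S) →
            V γ (at S a) ≡ cf S a - Σsub S a (λ i → β⋆ γ S i * (π i ÷′ π a))
lemma14 S valid γ _ a = begin
  V γ T
    ≡⟨ V-as-Σ γ T ⟩
  Σ (allPos T) (λ j → netCost γ (at T j) * π j)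
    ≡⟨ Σ-cong (allPos T) (λ j → *-distribʳ-- (π j) (cost (at T j)) (slack γ (at T j))) ⟩
  Σ (allPos T) (λ j → costWeight j - slackWeight j)
    ≡⟨ Σ-- (allPos T) costWeight slackWeight ⟩
  Σ (allPos T) costWeight - Σ (allPos T) slackWeight
    ≡⟨ cong₂ _-_ (sym cf-relative) (sym (Σsub-relative valid a (slack γ))) ⟩
  cf S a - Σsub S a (λ i → β⋆ γ S i * (π i ÷′ π a)) ∎
  where
  T : Tree
  T = at S a
  costWeight slackWeight : Pos T → ℚ
  costWeight j = cost (at T j) * π j
  slackWeight j = slack γ (at T j) * π j
  cf-relative : cf S a ≡ Σ (allPos T) costWeight
  cf-relative = trans
    (Σ-cong (allPos T) λ j → *-÷′-assoc (cAt S (extend a j)) (π (extend a j)) (π a))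
    (Σsub-relative valid a cost)
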